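{- Let $m,n\geq 3$ and $\ell\in\{0,\dots,n-1\}$. Suppose $C_m\Box C_n$ has a 2-factor $F$ which uses no edge joining a vertex of column $m-2$ to a vertex of column $m-1$ and which separates three vertices $x,y,z$. For a vertex $v$ let $v'=v$ if $v$ is not in column $m-1$, and $v'=u_{m-1,j-\ell}$ if $v=u_{m-1,j}$. Then $C_m\Box_\ell C_n$ has a 2-factor separating $x',y',z'$. In particular, if none of $x,y,z$ lies in column $m-1$, then $C_m\Box_\ell C_n$ has a 2-factor separating $x,y,z$.
   Context: The pseudo-Cartesian product $C_m\Box_\ell C_n$ has vertices $u_{i,j}$, $0\le i\le m-1$, $j\in\mathbb{Z}_n$, and edges $[u_{i,j},u_{i,j+1}]$ for all $i,j$, $[u_{i,j},u_{i+1,j}]$ for $0\le i\le m-2$, and $[u_{m-1,j},u_{0,j+\ell}]$ for all $j$ (second indices mod $n$); $C_m\Box C_n=C_m\Box_0 C_n$. Column $i$ is $\{u_{i,j}:j\in\mathbb{Z}_n\}$. A 2-factor is a spanning subgraph in which every vertex has valency 2; it separates a set $A$ of $k$ vertices if it consists of exactly $k$ cycles and $A$ meets the vertex set of each cycle in exactly one vertex. -}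

module Defs where

open import Data.Nat using (ℕ; zero; suc; _+_; _∸_; _≟_)
open import Data.Nat.DivMod using (_%_; m%n<n)
open import Data.Fin using (Fin; toℕ; fromℕ<)
open import Data.Product using (_×_; _,_; ∃; ∃-syntax; proj₁)
open import Data.Sum using (_⊎_)
open import Data.Empty using (⊥)
open import Relation.Nullary using (¬_; yes; no)
open import Relation.Binary.PropositionalEquality using (_≡_; _≢_)
open import Relation.Binary.Construct.Closure.ReflexiveTransitive using (Star)

-- Vertex u_{i,j} is (i , j) : column i ∈ {0..m-1}, second index j ∈ ℤ_n.
Vertex : ℕ → ℕ → Set
Vertex m n = Fin m × Fin n

-- j + k in ℤ_n  (for n = 0 the type Fin 0 is empty)
addMod : ∀ {n} → Fin n → ℕ → Fin n
addMod {suc n} j k = fromℕ< (m%n<n (toℕ j + k) (suc n))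

data Edge (m n ℓ : ℕ) : Vertex m n → Vertex m n → Set where
  horiz : ∀ i j → Edge m n ℓ (i , j) (i , addMod j 1)
  vert  : ∀ i i' j → toℕ i' ≡ suc (toℕ i) → Edge m n ℓ (i , j) (i' , j)
  wrap  : ∀ i i' j → toℕ i ≡ m ∸ 1 → toℕ i' ≡ 0 → Edge m n ℓ (i , j) (i' , addMod j ℓ)

Adj : (m n ℓ : ℕ) → Vertex m n → Vertex m n → Set
Adj m n ℓ u v = Edge m n ℓ u v ⊎ Edge m n ℓ v u

TwoFactor : ∀ {V : Set} → (V → V → Set) → (V → V → Set) → Set
TwoFactor {V} G F =
  (∀ u v → F u v → G u v) ×
  (∀ u v → F u v → F v u) ×
  (∀ v → ∃[ a ] ∃[ b ] (a ≢ b × F v a × F v b × (∀ w → F v w → w ≡ a ⊎ w ≡ b)))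

SameCycle : ∀ {V : Set} → (V → V → Set) → V → V → Set
SameCycle F = Star F

-- F separates {x,y,z}: F has exactly three cycles (components), each
-- containing exactly one of x, y, z.  (x,y,z pairwise in distinct
-- components, and every vertex in the component of one of them.)
Separates3 : ∀ {V : Set} → (V → V → Set) → V → V → V → Set
Separates3 F x y z =
  ¬ SameCycle F x y × ¬ SameCycle F x z × ¬ SameCycle F y z ×
  (∀ v → SameCycle F v x ⊎ SameCycle F v y ⊎ SameCycle F v z)

AvoidsCols : ∀ {m n} → (Vertex m n → Vertex m n → Set) → Set
AvoidsCols {m} {n} F =
  ∀ (u v : Vertex m n) → F u v →
    ¬ ((toℕ (proj₁ u) ≡ m ∸ 2 × toℕ (proj₁ v) ≡ m ∸ 1) ⊎
       (toℕ (proj₁ v) ≡ m ∸ 2 × toℕ (proj₁ u) ≡ m ∸ 1))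

-- v' : v if v not in column m-1; u_{m-1,j-ℓ} if v = u_{m-1,j}
-- (j - ℓ computed as j + (n - ℓ) mod n, with ℓ < n)
prime : (m n ℓ : ℕ) → Vertex m n → Vertex m n
prime m n ℓ (i , j) with toℕ i ≟ m ∸ 1
... | yes _ = (i , addMod j (n ∸ ℓ))
... | no _  = (i , j)

{-# OPTIONS --safe #-}
module Submission where

open import Defs
open import Data.Nat using (ℕ; suc; _+_; _∸_; _≤_; _<_; s≤s; _≟_)
open import Data.Nat.Properties using (+-assoc; +-comm; m∸n+n≡m; <⇒≤; <⇒≢; suc-injective; 0≢1+n)
open import Data.Nat.DivMod using (_%_; %-distribˡ-+; m%n%n≡m%n; m<n⇒m%n≡m; n%n≡0)
open import Data.Fin using (Fin; toℕ)
open import Data.Fin.Properties using (toℕ-fromℕ<; toℕ-injective; toℕ<n)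
open import Data.Product using (_×_; _,_; proj₁; ∃-syntax)
open import Data.Sum as Sum using (_⊎_; inj₁; inj₂)
open import Function using (_∘_; id; _on_)
open import Relation.Nullary using (¬_; yes; no; contradiction)
open import Relation.Binary.PropositionalEquality
open import Relation.Binary.Construct.Closure.ReflexiveTransitive using (gmap)

-- The relabelling v ↦ v' shifts column m-1 by -ℓ, so it is a bijection of the vertex set.  It maps
-- every edge of C_m □ C_n not joining columns m-2 and m-1 onto an edge of C_m □_ℓ C_n: edges inside
-- column m-1 move along it, and [u_{m-1,j}, u_{0,j}] becomes [u_{m-1,j-ℓ}, u_{0,j}].  Hence the image
-- of F is a 2-factor of C_m □_ℓ C_n whose cycles are those of F, relabelled.

module _ {V W : Set} {σ : V → W} {τ : W → V}
         (τ∘σ : ∀ a → τ (σ a) ≡ a) (σ∘τ : ∀ w → σ (τ w) ≡ w) where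

  σ-injective : ∀ {a b} → σ a ≡ σ b → a ≡ b
  σ-injective {a} {b} σa≡σb = trans (sym (τ∘σ a)) (trans (cong τ σa≡σb) (τ∘σ b))

  τ≡⇒≡σ : ∀ {w a} → τ w ≡ a → w ≡ σ a
  τ≡⇒≡σ {w} τw≡a = trans (sym (σ∘τ w)) (cong σ τw≡a)

  TwoFactor-on : ∀ {G : V → V → Set} {H : W → W → Set} {F : V → V → Set} →
                 (∀ a b → F a b → G a b → H (σ a) (σ b)) →
                 TwoFactor G F → TwoFactor H (F on τ)
  TwoFactor-on {G} {H} {F} σ-edge (F⊆G , F-sym , F-deg) =
    F∘τ⊆H , (λ u v → F-sym (τ u) (τ v)) , F∘τ-deg
    where
    F∘τ⊆H : ∀ u v → F (τ u) (τ v) → H u v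
    F∘τ⊆H u v f = subst₂ H (σ∘τ u) (σ∘τ v) (σ-edge _ _ f (F⊆G _ _ f))

    F∘τ-deg : ∀ v → ∃[ a ] ∃[ b ] (a ≢ b × F (τ v) (τ a) × F (τ v) (τ b) ×
                                   (∀ w → F (τ v) (τ w) → w ≡ a ⊎ w ≡ b))
    F∘τ-deg v with F-deg (τ v)
    ... | a , b , a≢b , fa , fb , only-a-b =
      σ a , σ b , a≢b ∘ σ-injective ,
      subst (F (τ v)) (sym (τ∘σ a)) fa , subst (F (τ v)) (sym (τ∘σ b)) fb ,
      λ w f → Sum.map τ≡⇒≡σ τ≡⇒≡σ (only-a-b (τ w) f)

  module _ {F : V → V → Set} where

    SameCycle-on⁺ : ∀ {a b} → SameCycle F a b → SameCycle (F on τ) (σ a) (σ b)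
    SameCycle-on⁺ = gmap σ (λ {a} {b} → subst₂ F (sym (τ∘σ a)) (sym (τ∘σ b)))

    SameCycle-on⁻ : ∀ {a b} → SameCycle (F on τ) (σ a) (σ b) → SameCycle F a b
    SameCycle-on⁻ {a} {b} = subst₂ (SameCycle F) (τ∘σ a) (τ∘σ b) ∘ gmap τ id

    Separates3-on : ∀ {x y z} → Separates3 F x y z → Separates3 (F on τ) (σ x) (σ y) (σ z)
    Separates3-on {x} {y} {z} (x≁y , x≁z , y≁z , covered) =
      x≁y ∘ SameCycle-on⁻ , x≁z ∘ SameCycle-on⁻ , y≁z ∘ SameCycle-on⁻ , covered-on
      where
      reach : ∀ v {c} → SameCycle F (τ v) c → SameCycle (F on τ) v (σ c)
      reach v = subst (λ u → SameCycle (F on τ) u _) (σ∘τ v) ∘ SameCycle-on⁺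

      covered-on : ∀ v → SameCycle (F on τ) v (σ x) ⊎ SameCycle (F on τ) v (σ y) ⊎
                         SameCycle (F on τ) v (σ z)
      covered-on v = Sum.map (reach v) (Sum.map (reach v) (reach v)) (covered (τ v))

module _ {N : ℕ} where
  private
    n = suc N

  +-cong-% : ∀ a a′ b b′ → a % n ≡ a′ % n → b % n ≡ b′ % n →
             (a + b) % n ≡ (a′ + b′) % n
  +-cong-% a a′ b b′ a≡a′ b≡b′ = begin
    (a + b) % n                ≡⟨ %-distribˡ-+ a b n ⟩
    (a % n + b % n) % n        ≡⟨ cong₂ (λ s t → (s + t) % n) a≡a′ b≡b′ ⟩
    (a′ % n + b′ % n) % n      ≡⟨ %-distribˡ-+ a′ b′ n ⟨
    (a′ + b′) % n              ∎
    where open ≡-Reasoning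

  toℕ-addMod : (j : Fin n) (a : ℕ) → toℕ (addMod j a) ≡ (toℕ j + a) % n
  toℕ-addMod j a = toℕ-fromℕ< _

  addMod-+ : (j : Fin n) (a b : ℕ) → addMod (addMod j a) b ≡ addMod j (a + b)
  addMod-+ j a b = toℕ-injective (begin
    toℕ (addMod (addMod j a) b)  ≡⟨ toℕ-addMod (addMod j a) b ⟩
    (toℕ (addMod j a) + b) % n   ≡⟨ +-cong-% (toℕ (addMod j a)) (toℕ j + a) b b toℕ-addMod-% refl ⟩
    (toℕ j + a + b) % n          ≡⟨ cong (_% n) (+-assoc (toℕ j) a b) ⟩
    (toℕ j + (a + b)) % n        ≡⟨ toℕ-addMod j (a + b) ⟨
    toℕ (addMod j (a + b))       ∎)
    where
    open ≡-Reasoning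
    toℕ-addMod-% : toℕ (addMod j a) % n ≡ (toℕ j + a) % n
    toℕ-addMod-% = trans (cong (_% n) (toℕ-addMod j a)) (m%n%n≡m%n (toℕ j + a) n)

  addMod-comm : (j : Fin n) (a b : ℕ) → addMod (addMod j a) b ≡ addMod (addMod j b) a
  addMod-comm j a b = begin
    addMod (addMod j a) b  ≡⟨ addMod-+ j a b ⟩
    addMod j (a + b)       ≡⟨ cong (addMod j) (+-comm a b) ⟩
    addMod j (b + a)       ≡⟨ addMod-+ j b a ⟨
    addMod (addMod j b) a  ∎
    where open ≡-Reasoning

  addMod-cong : (j : Fin n) {a b : ℕ} → a % n ≡ b % n → addMod j a ≡ addMod j b
  addMod-cong j {a} {b} a≡b = toℕ-injective (begin
    toℕ (addMod j a)   ≡⟨ toℕ-addMod j a ⟩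
    (toℕ j + a) % n    ≡⟨ +-cong-% (toℕ j) (toℕ j) a b refl a≡b ⟩
    (toℕ j + b) % n    ≡⟨ toℕ-addMod j b ⟨
    toℕ (addMod j b)   ∎)
    where open ≡-Reasoning

  addMod-0 : (j : Fin n) → addMod j 0 ≡ j
  addMod-0 j = toℕ-injective (trans (toℕ-addMod j 0)
                 (trans (cong (_% n) (+-comm (toℕ j) 0)) (m<n⇒m%n≡m (toℕ<n j))))

shiftLast : ∀ {m n} → ℕ → Vertex m n → Vertex m n
shiftLast {m} s (i , j) with toℕ i ≟ m ∸ 1
... | yes _ = i , addMod j s
... | no _  = i , j

prime≡shiftLast : ∀ m n ℓ (v : Vertex m n) → prime m n ℓ v ≡ shiftLast (n ∸ ℓ) v
prime≡shiftLast m n ℓ (i , j) with toℕ i ≟ m ∸ 1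
... | yes _ = refl
... | no _  = refl

shiftLast-last : ∀ {m n} s {i : Fin m} {j : Fin n} →
                 toℕ i ≡ m ∸ 1 → shiftLast s (i , j) ≡ (i , addMod j s)
shiftLast-last {m} s {i} last with toℕ i ≟ m ∸ 1
... | yes _       = refl
... | no not-last = contradiction last not-last

shiftLast-other : ∀ {m n} s {i : Fin m} {j : Fin n} →
                  toℕ i ≢ m ∸ 1 → shiftLast s (i , j) ≡ (i , j)
shiftLast-other {m} s {i} not-last with toℕ i ≟ m ∸ 1
... | yes last = contradiction last not-last
... | no _     = refl

shiftLast-cancel : ∀ {m N} s t → (s + t) % suc N ≡ 0 →
                   (v : Vertex m (suc N)) → shiftLast t (shiftLast s v) ≡ v
shiftLast-cancel {m} s t s+t≡0 (i , j) with toℕ i ≟ m ∸ 1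
... | no not-last = shiftLast-other t not-last
... | yes last     = trans (shiftLast-last t last) (cong (i ,_) (begin
  addMod (addMod j s) t  ≡⟨ addMod-+ j s t ⟩
  addMod j (s + t)       ≡⟨ addMod-cong j s+t≡0 ⟩
  addMod j 0             ≡⟨ addMod-0 j ⟩
  j                      ∎))
  where open ≡-Reasoning

Crosses : ∀ {m n} → Vertex m n → Vertex m n → Set
Crosses {m} u v = toℕ (proj₁ u) ≡ m ∸ 2 × toℕ (proj₁ v) ≡ m ∸ 1

shiftLast-Edge : ∀ {k N} s {ℓ₀ ℓ} {a b : Vertex (suc (suc k)) (suc N)} →
                 (s + ℓ) % suc N ≡ ℓ₀ % suc N → ¬ Crosses a b →
                 Edge _ _ ℓ₀ a b → Edge _ _ ℓ (shiftLast s a) (shiftLast s b)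
shiftLast-Edge {k} s _ _ (horiz i j) with toℕ i ≟ suc k
... | yes _ = subst (λ j′ → Edge _ _ _ (i , addMod j s) (i , j′))
                    (addMod-comm j s 1) (horiz i (addMod j s))
... | no _  = horiz i j
shiftLast-Edge {k} s _ ¬crosses (vert i i′ j i′≡1+i) with toℕ i ≟ suc k | toℕ i′ ≟ suc k
... | yes i≡1+k | _ = contradiction (trans i′≡1+i (cong suc i≡1+k)) (<⇒≢ (toℕ<n i′))
... | no _ | yes i′≡1+k =
  contradiction (suc-injective (trans (sym i′≡1+i) i′≡1+k) , i′≡1+k) ¬crosses
... | no _ | no _ = vert i i′ j i′≡1+i
shiftLast-Edge {k} s {ℓ₀} {ℓ} s+ℓ≡ℓ₀ _ (wrap i i′ j i≡1+k i′≡0)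
  with toℕ i ≟ suc k | toℕ i′ ≟ suc k
... | no i≢1+k | _ = contradiction i≡1+k i≢1+k
... | yes _ | yes i′≡1+k = contradiction (trans (sym i′≡0) i′≡1+k) 0≢1+n
... | yes _ | no _ =
  subst (λ j′ → Edge _ _ ℓ _ (i′ , j′)) shifted-twist (wrap i i′ (addMod j s) i≡1+k i′≡0)
  where
  shifted-twist : addMod (addMod j s) ℓ ≡ addMod j ℓ₀
  shifted-twist = trans (addMod-+ j s ℓ) (addMod-cong j s+ℓ≡ℓ₀)

shiftLast-Adj : ∀ {k N} s {ℓ₀ ℓ} {a b : Vertex (suc (suc k)) (suc N)} →
                (s + ℓ) % suc N ≡ ℓ₀ % suc N → ¬ (Crosses a b ⊎ Crosses b a) →
                Adj _ _ ℓ₀ a b → Adj _ _ ℓ (shiftLast s a) (shiftLast s b)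
shiftLast-Adj s s+ℓ≡ℓ₀ ¬crosses = Sum.map (shiftLast-Edge s s+ℓ≡ℓ₀ (¬crosses ∘ inj₁))
                                           (shiftLast-Edge s s+ℓ≡ℓ₀ (¬crosses ∘ inj₂))

lemma3p5 : (m n ℓ : ℕ) → 3 ≤ m → 3 ≤ n → ℓ < n →
    (F : Vertex m n → Vertex m n → Set) → (x y z : Vertex m n) →
    TwoFactor (Adj m n 0) F → AvoidsCols F → Separates3 F x y z →
    ∃[ F' ] (TwoFactor (Adj m n ℓ) F' ×
    Separates3 F' (prime m n ℓ x) (prime m n ℓ y) (prime m n ℓ z))
lemma3p5 m@(suc (suc _)) n@(suc _) ℓ (s≤s (s≤s _)) _ ℓ<n F x y z F-2factor avoids separates =
  (F on shiftLast ℓ) ,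
  TwoFactor-on τ∘σ σ∘τ σ-edge F-2factor ,
  Separates3-on τ∘σ σ∘τ separates
  where
  n∸ℓ+ℓ≡0 : (n ∸ ℓ + ℓ) % n ≡ 0
  n∸ℓ+ℓ≡0 = trans (cong (_% n) (m∸n+n≡m (<⇒≤ ℓ<n))) (n%n≡0 n)

  ℓ+n∸ℓ≡0 : (ℓ + (n ∸ ℓ)) % n ≡ 0
  ℓ+n∸ℓ≡0 = trans (cong (_% n) (+-comm ℓ (n ∸ ℓ))) n∸ℓ+ℓ≡0

  τ∘σ : ∀ v → shiftLast ℓ (prime m n ℓ v) ≡ v
  τ∘σ v = trans (cong (shiftLast ℓ) (prime≡shiftLast m n ℓ v))
                (shiftLast-cancel (n ∸ ℓ) ℓ n∸ℓ+ℓ≡0 v)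

  σ∘τ : ∀ v → prime m n ℓ (shiftLast ℓ v) ≡ v
  σ∘τ v = trans (prime≡shiftLast m n ℓ _)
                (shiftLast-cancel ℓ (n ∸ ℓ) ℓ+n∸ℓ≡0 v)

  σ-edge : ∀ a b → F a b → Adj m n 0 a b → Adj m n ℓ (prime m n ℓ a) (prime m n ℓ b)
  σ-edge a b f = subst₂ (Adj m n ℓ) (sym (prime≡shiftLast m n ℓ a)) (sym (prime≡shiftLast m n ℓ b))
               ∘ shiftLast-Adj (n ∸ ℓ) n∸ℓ+ℓ≡0 (avoids a b f)
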